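{- Let $\mathcal{N}(P,E)$ be a ported (unoriented or oriented) matroid and let $O$ be a linear ordering of $P\sqcup E$ in which every element of $P$ precedes every element of $E$. Let $\mathcal{T}$ be the unique ported computation tree for $\mathcal{N}$ in which, at each non-leaf node, the element deleted and contracted is the $O$-greatest non-separating element of $E$ in that node's matroid. Then for every $P$-subbasis $F$ and every $e\in E$: $e$ is internally active (resp. internally inactive, externally active, externally inactive) with respect to $O$ and $F$ if and only if $e$ is internally active (resp. internally passive, externally active, externally passive) with respect to the leaf of $\mathcal{T}$ to which $F$ belongs.
   Context: A ported matroid (or oriented matroid) $\mathcal{N}(P,E)$ is a matroid (oriented matroid) on $P\sqcup E$ with a distinguished set $P$ of ports. An element is non-separating if it is neither a loop nor a coloop. A $P$-subbasis is an independent set $F\subseteq E$ such that $F\cup P$ spans $\mathcal{N}$. Activities with respect to $O$ and a $P$-subbasis $F$: choose any basis $B\supseteq F$ of $\mathcal{N}$ (the notions do not depend on this choice). An element $e\in F$ is internally active if $e$ is the $O$-least element of its principal cocircuit with respect to $B$ (the unique cocircuit contained in $(P\sqcup E)\setminus(B\setminus e)$), and internally inactive otherwise; an element $e\in E\setminus F$ is externally active if $e$ is the $O$-least element of its principal circuit with respect to $B$ (the unique circuit contained in $B\cup e$), and externally inactive otherwise. A ported computation tree for $\mathcal{N}$ is a rooted binary tree with root labeled $\mathcal{N}$ such that: if $\mathcal{N}$ has a non-separating element not in $P$, then for some such $e$ the root has two subtrees, a ported computation tree for $\mathcal{N}/e$ (branch labeled "$e$ contracted") and one for $\mathcal{N}\setminus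 e$ (branch labeled "$e$ deleted"); otherwise the root is a leaf. For a leaf and its root path: $e\in E$ labeled "contracted" on the path is internally passive; a coloop $e\in E$ of the leaf's matroid is internally active; $e\in E$ labeled "deleted" on the path is externally passive; a loop $e\in E$ of the leaf's matroid is externally active. The internally active or passive elements of a leaf form a $P$-subbasis, said to belong to the leaf; each $P$-subbasis belongs to a unique leaf. -}

module Defs where

open import Data.Nat using (ℕ; _<_; _≤_)
open import Data.Fin using (Fin)
open import Data.Fin.Subset using (Subset; _∈_; _∉_; _⊆_; _⊂_; _∪_; _─_; _-_; ∁; ⁅_⁆; ∣_∣; Nonempty)
  renaming (⊥ to ∅)
open import Data.Product using (Σ; ∃; ∃-syntax; _×_; _,_)
open import Relation.Nullary using (¬_; Dec)
open import Relation.Binary.PropositionalEquality using (_≡_)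
import Data.Sum

record Matroid (n : ℕ) : Set₁ where
  field
    Indep     : Subset n → Set
    indep?    : (X : Subset n) → Dec (Indep X)
    indep-∅   : Indep ∅
    indep-⊆   : ∀ {X Y} → X ⊆ Y → Indep Y → Indep X
    indep-aug : ∀ {X Y} → Indep X → Indep Y → ∣ X ∣ < ∣ Y ∣ →
                ∃[ e ] (e ∈ Y × e ∉ X × Indep (X ∪ ⁅ e ⁆))

-- Notions for a "set system": a ground set G together with an
-- independence predicate I (used both for a matroid and for its minors).

module SetSystem {n : ℕ} (G : Subset n) (I : Subset n → Set) where

  Basis : Subset n → Set
  Basis B = B ⊆ G × I B × (∀ e → e ∈ G → e ∉ B → ¬ I (B ∪ ⁅ e ⁆))

  Loop : Fin n → Set
  Loop e = e ∈ G × ¬ I ⁅ e ⁆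

  Coloop : Fin n → Set
  Coloop e = e ∈ G × (∀ B → Basis B → e ∈ B)

  NonSeparating : Fin n → Set
  NonSeparating e = e ∈ G × ¬ Loop e × ¬ Coloop e

  Circuit : Subset n → Set
  Circuit X = X ⊆ G × ¬ I X × (∀ Y → Y ⊂ X → I Y)

  MeetsAllBases : Subset n → Set
  MeetsAllBases X = ∀ B → Basis B → ∃[ e ] (e ∈ X × e ∈ B)

  -- minimal subsets of G meeting every basis (= circuits of the dual)
  Cocircuit : Subset n → Set
  Cocircuit X = X ⊆ G × MeetsAllBases X × (∀ Y → Y ⊂ X → ¬ MeetsAllBases Y)

  Spans : Subset n → Set
  Spans X = ∃[ B ] (Basis B × B ⊆ X)

-- Minors M / C \ D on the ground set Fin n minus (C ∪ D).
-- X is independent in M / C \ D iff X avoids C ∪ D and X ∪ B_C is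
-- independent in M for some basis B_C of the restriction M | C.

module _ {n : ℕ} (M : Matroid n) where
  open Matroid M

  minorGround : Subset n → Subset n → Subset n
  minorGround C D = ∁ (C ∪ D)

  MinorIndep : Subset n → Subset n → Subset n → Set
  MinorIndep C D X =
    X ⊆ minorGround C D ×
    ∃[ BC ] (SetSystem.Basis C Indep BC × Indep (X ∪ BC))

  module Whole = SetSystem (∁ ∅) Indep
  module Minor (C D : Subset n) = SetSystem (minorGround C D) (MinorIndep C D)

  -- Ported matroid N(P,E): P = ports, E = ∁ P.  O : Fin n → ℕ injective
  -- is the linear order (a <_O b iff O a < O b).

  IsOLeast : (Fin n → ℕ) → Fin n → Subset n → Set
  IsOLeast O e X = e ∈ X × (∀ f → f ∈ X → O e ≤ O f)

  PSubbasis : Subset n → Subset n → Set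
  PSubbasis P F = F ⊆ ∁ P × Indep F × Whole.Spans (F ∪ P)

  -- a basis B ⊇ F of N with B ∩ E = F (i.e. B ⊆ F ∪ P)
  AdaptedBasis : Subset n → Subset n → Subset n → Set
  AdaptedBasis P F B = Whole.Basis B × F ⊆ B × B ⊆ F ∪ P

  InternallyActive : Subset n → (Fin n → ℕ) → Subset n → Fin n → Set
  InternallyActive P O F e =
    e ∈ F × ∃[ B ] (AdaptedBasis P F B ×
      ∃[ X ] (Whole.Cocircuit X × (∀ f → f ∈ X → f ∉ (B - e)) × IsOLeast O e X))

  InternallyInactive : Subset n → (Fin n → ℕ) → Subset n → Fin n → Set
  InternallyInactive P O F e = e ∈ F × ¬ InternallyActive P O F e

  ExternallyActive : Subset n → (Fin n → ℕ) → Subset n → Fin n → Set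
  ExternallyActive P O F e =
    e ∉ P × e ∉ F × ∃[ B ] (AdaptedBasis P F B ×
      ∃[ X ] (Whole.Circuit X × X ⊆ (B ∪ ⁅ e ⁆) × IsOLeast O e X))

  ExternallyInactive : Subset n → (Fin n → ℕ) → Subset n → Fin n → Set
  ExternallyInactive P O F e = e ∉ P × e ∉ F × ¬ ExternallyActive P O F e

  GreatestNonSep : Subset n → (Fin n → ℕ) → Subset n → Subset n → Fin n → Set
  GreatestNonSep P O C D e =
    e ∉ P × Minor.NonSeparating C D e ×
    (∀ f → f ∉ P → Minor.NonSeparating C D f → O f ≤ O e)

  -- Node P O C D : the node of T reached from the root by contracting
  -- exactly the elements of C and deleting exactly those of D.
  data Node (P : Subset n) (O : Fin n → ℕ) : Subset n → Subset n → Set where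
    root     : Node P O ∅ ∅
    contract : ∀ {C D e} → Node P O C D → GreatestNonSep P O C D e →
               Node P O (C ∪ ⁅ e ⁆) D
    delete   : ∀ {C D e} → Node P O C D → GreatestNonSep P O C D e →
               Node P O C (D ∪ ⁅ e ⁆)

  Leaf : Subset n → (Fin n → ℕ) → Subset n → Subset n → Set
  Leaf P O C D =
    Node P O C D × (∀ e → e ∉ P → ¬ Minor.NonSeparating C D e)

  LeafInternallyPassive : Subset n → Subset n → Subset n → Fin n → Set
  LeafInternallyPassive P C D e = e ∉ P × e ∈ C

  LeafInternallyActive : Subset n → Subset n → Subset n → Fin n → Set
  LeafInternallyActive P C D e = e ∉ P × Minor.Coloop C D e

  LeafExternallyPassive : Subset n → Subset n → Subset n → Fin n → Set
  LeafExternallyPassive P C D e = e ∉ P × e ∈ D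

  LeafExternallyActive : Subset n → Subset n → Subset n → Fin n → Set
  LeafExternallyActive P C D e = e ∉ P × Minor.Loop C D e

  BelongsTo : Subset n → Subset n → Subset n → Subset n → Set
  BelongsTo P F C D = ∀ e →
    (e ∈ F → LeafInternallyPassive P C D e Data.Sum.⊎ LeafInternallyActive P C D e) ×
    (LeafInternallyPassive P C D e Data.Sum.⊎ LeafInternallyActive P C D e → e ∈ F)

-- Follow the path from the root of the tree to the leaf M / C ＼ D. Each step removes the
-- O-greatest non-separating element d of E, so every removed element is O-greater than all
-- non-separating elements of E that remain. Using this, and that P precedes E, one carries
-- four closure statements along the path: a contracted element lies in the closure of the
-- other contracted elements, the smaller elements and the coloops in E; a deleted element
-- lies outside the closure of larger contracted elements and coloops in E; a coloop e in E
-- lies outside the closure of any set avoiding e and the deleted elements above e; and a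
-- loop in E lies in the closure of the larger contracted elements. At the leaf every element
-- of E is contracted, deleted, a loop or a coloop, and for a basis B ⊇ F inside F ∪ P these
-- statements decide whether e is O-least in its fundamental cocircuit or circuit.

{-# OPTIONS --safe #-}
module Submission where

open import Defs
open import Data.Empty using (⊥-elim)
open import Data.Fin using (Fin; zero; suc; _≟_)
open import Data.Fin.Properties using (any?; all?)
open import Data.Fin.Subset
  using (Subset; _∈_; _∉_; _⊆_; _⊂_; _⊃_; _∪_; _─_; _-_; ∁; ⁅_⁆; ∣_∣; inside; outside)
  renaming (⊥ to ∅)
open import Data.Fin.Subset.Induction using (Acc; acc; ⊂-wellFounded; ⊃-wellFounded)
open import Data.Fin.Subset.Properties
  using (p⊆p∪q; q⊆p∪q; x∈p∪q⁻; x∈⁅x⁆; x∈⁅y⁆⇒x≡y; x∉⁅y⁆⇒x≢y; x∉p⇒x∈∁p; x∈∁p⇒x∉p; ∉⊥; ⊥⊆; ⊆-trans;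
         p─q⊆p; x∈p∧x∉q⇒x∈p─q; x≢y⇒x∉⁅y⁆; p⊆q⇒∁p⊇∁q; x∈p∧x≢y⇒x∈p-y; p⊂q⇒p⊆q; p⊂q⇒∣p∣<∣q∣; ∪-comm;
         anySubset?; _∈?_; _⊆?_; _⊂?_)
open import Data.Nat using (ℕ; _<_; _≤_; _<?_; _≤?_)
open import Data.Nat.Properties using (≤∧≢⇒<; ≰⇒>; <⇒≱; <⇒≤; ≤-refl; <-irrefl; <-asym; ≤-<-trans; ≮⇒≥)
open import Data.Product using (∃; ∃-syntax; _×_; _,_; proj₁; proj₂)
import Data.Product as Product
open import Data.Sum using (_⊎_; inj₁; inj₂; [_,_]′)
import Data.Sum as Sum
open import Data.Vec using (_∷_; there; tabulate)
open import Data.Vec.Properties using (lookup∘tabulate; []=⇒lookup; lookup⇒[]=)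
open import Function using (_∘_; id)
open import Function.Bundles using (_⇔_; mk⇔)
open import Function.Definitions using (Injective)
open import Relation.Nullary using (¬_; Dec; yes; no; does)
open import Relation.Nullary.Decidable using (_×-dec_; _→-dec_; ¬?; decidable-stable; dec-true)
open import Relation.Unary using (Decidable)
open import Relation.Binary.PropositionalEquality using (_≡_; _≢_; refl; sym; trans; subst)

-- Finite subsets

private
  variable
    n : ℕ
    p q r : Subset n
    x y : Fin n

∈∪ˡ : x ∈ p → x ∈ p ∪ q
∈∪ˡ {q = q} = p⊆p∪q q

∈∪ʳ : x ∈ q → x ∈ p ∪ q
∈∪ʳ {q = q} {p = p} = q⊆p∪q p q

∈∪⁻ : x ∈ p ∪ q → x ∈ p ⊎ x ∈ q
∈∪⁻ {p = p} {q = q} = x∈p∪q⁻ p q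

x∈p∪⁅y⁆⁻ : x ∈ p ∪ ⁅ y ⁆ → x ∈ p ⊎ x ≡ y
x∈p∪⁅y⁆⁻ x∈p∪⁅y⁆ = Sum.map₂ (x∈⁅y⁆⇒x≡y _) (∈∪⁻ x∈p∪⁅y⁆)

∪-lub : p ⊆ r → q ⊆ r → p ∪ q ⊆ r
∪-lub p⊆r q⊆r x∈p∪q = [ p⊆r , q⊆r ]′ (∈∪⁻ x∈p∪q)

∪-mono : ∀ {p′ q′ : Subset n} → p ⊆ p′ → q ⊆ q′ → p ∪ q ⊆ p′ ∪ q′
∪-mono p⊆p′ q⊆q′ = ∪-lub (∈∪ˡ ∘ p⊆p′) (∈∪ʳ ∘ q⊆q′)

⁅⁆⊆ : x ∈ p → ⁅ x ⁆ ⊆ p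
⁅⁆⊆ {p = p} x∈p y∈⁅x⁆ with refl ← x∈⁅y⁆⇒x≡y _ y∈⁅x⁆ = x∈p

∈∁∅ : x ∈ ∁ ∅
∈∁∅ = x∉p⇒x∈∁p ∉⊥

x∈∁[p∪q]⁺ : x ∉ p → x ∉ q → x ∈ ∁ (p ∪ q)
x∈∁[p∪q]⁺ x∉p x∉q = x∉p⇒x∈∁p ([ x∉p , x∉q ]′ ∘ ∈∪⁻)

x∈∁[p∪q]⁻ : x ∈ ∁ (p ∪ q) → x ∉ p × x ∉ q
x∈∁[p∪q]⁻ x∈∁[p∪q] = x∈∁p⇒x∉p x∈∁[p∪q] ∘ ∈∪ˡ , x∈∁p⇒x∉p x∈∁[p∪q] ∘ ∈∪ʳ

x∈p─q⇒x∉q : ∀ (p q : Subset n) {x} → x ∈ p ─ q → x ∉ q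
x∈p─q⇒x∉q (_ ∷ _) (inside  ∷ _) {zero}  ()
x∈p─q⇒x∉q (_ ∷ _) (outside ∷ _) {zero}  _           ()
x∈p─q⇒x∉q (_ ∷ p) (_       ∷ q) {suc x} (there x∈) (there x∈q) = x∈p─q⇒x∉q p q x∈ x∈q

x∈p-y⇒x∈p : x ∈ p - y → x ∈ p
x∈p-y⇒x∈p {p = p} {y = y} = p─q⊆p p ⁅ y ⁆

x∈p-y⇒x≢y : x ∈ p - y → x ≢ y
x∈p-y⇒x≢y {p = p} {y = y} x∈p-y refl = x∈p─q⇒x∉q p ⁅ y ⁆ x∈p-y (x∈⁅x⁆ y)

p⊆p-x∪⁅x⁆ : p ⊆ (p - x) ∪ ⁅ x ⁆
p⊆p-x∪⁅x⁆ {p = p} {x = x} {y} y∈p with y ≟ x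
... | yes refl = ∈∪ʳ (x∈⁅x⁆ x)
... | no y≢x   = ∈∪ˡ (x∈p∧x≢y⇒x∈p-y y∈p y≢x)

∣p∣<∣p∪⁅x⁆∣ : x ∉ p → ∣ p ∣ < ∣ p ∪ ⁅ x ⁆ ∣
∣p∣<∣p∪⁅x⁆∣ {x = x} x∉p = p⊂q⇒∣p∣<∣q∣ (∈∪ˡ , x , ∈∪ʳ (x∈⁅x⁆ x) , x∉p)

module _ {Q : Fin n → Set} (Q? : Decidable Q) where

  subsetOf : Subset n
  subsetOf = tabulate (does ∘ Q?)

  ∈subsetOf⁺ : Q x → x ∈ subsetOf
  ∈subsetOf⁺ {x} Qx = lookup⇒[]= x _ (trans (lookup∘tabulate _ x) (dec-true (Q? x) Qx))

  ∈subsetOf⁻ : x ∈ subsetOf → Q x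
  ∈subsetOf⁻ {x} x∈ with Q? x | trans (sym (lookup∘tabulate (does ∘ Q?) x)) ([]=⇒lookup x∈)
  ... | yes Qx | _ = Qx

minimalSubset : ∀ {Q : Subset n → Set} → Decidable Q → Q p →
                ∃[ X ] (X ⊆ p × Q X × ∀ Y → Y ⊂ X → ¬ Q Y)
minimalSubset {Q = Q} Q? = go (⊂-wellFounded _)
  where
  go : Acc _⊂_ p → Q p → ∃[ X ] (X ⊆ p × Q X × ∀ Y → Y ⊂ X → ¬ Q Y)
  go {p} (acc smaller) Qp with anySubset? (λ Y → Y ⊂? p ×-dec Q? Y)
  ... | yes (Y , Y⊂p , QY) =
    let (X , X⊆Y , QX , minX) = go (smaller Y⊂p) QY in X , ⊆-trans X⊆Y (p⊂q⇒p⊆q Y⊂p) , QX , minX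
  ... | no none = p , id , Qp , λ Y Y⊂p QY → none (Y , Y⊂p , QY)

-- Closure in a matroid

module Closure {n : ℕ} (M : Matroid n) where
  open Matroid M

  private
    variable
      A A′ I J K S T X X₀ : Subset n

  BasisOf : Subset n → Subset n → Set
  BasisOf A = SetSystem.Basis A Indep

  -- x ∉cl A: x lies outside the closure of A. Closure membership _∈cl_ is
  -- its negation, which loses nothing since ∉cl? decides it.
  infix 4 _∉cl_ _∈cl_

  _∉cl_ : Fin n → Subset n → Set
  x ∉cl A = ∀ J → BasisOf A J → x ∉ J × Indep (J ∪ ⁅ x ⁆)

  _∈cl_ : Fin n → Subset n → Set
  x ∈cl A = ¬ x ∉cl A

  Spanning : Subset n → Set
  Spanning A = ∀ x → x ∈cl A

  extendToBasisOf : I ⊆ A → Indep I → ∃[ J ] (I ⊆ J × BasisOf A J)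
  extendToBasisOf {A = A} = go (⊃-wellFounded _)
    where
    go : Acc _⊃_ I → I ⊆ A → Indep I → ∃[ J ] (I ⊆ J × BasisOf A J)
    go {I} (acc larger) I⊆A indI
      with any? (λ y → y ∈? A ×-dec ¬? (y ∈? I) ×-dec indep? (I ∪ ⁅ y ⁆))
    ... | yes (y , y∈A , y∉I , indIy) =
      let (J , Iy⊆J , basisJ) = go (larger (∈∪ˡ , y , ∈∪ʳ (x∈⁅x⁆ y) , y∉I)) (∪-lub I⊆A (⁅⁆⊆ y∈A)) indIy
      in J , Iy⊆J ∘ ∈∪ˡ , basisJ
    ... | no none = I , id , I⊆A , indI , λ y y∈A y∉I indIy → none (y , y∈A , y∉I , indIy)

  basisOf-exists : ∀ A → ∃ (BasisOf A)
  basisOf-exists A = let (J , _ , basisJ) = extendToBasisOf {A = A} ⊥⊆ indep-∅ in J , basisJ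

  basisOf-self : Indep J → BasisOf J J
  basisOf-self indJ = id , indJ , λ y y∈J y∉J → ⊥-elim (y∉J y∈J)

  basisOf-restrict : BasisOf A′ K → K ⊆ A → A ⊆ A′ → BasisOf A K
  basisOf-restrict (_ , indK , maxK) K⊆A A⊆A′ = K⊆A , indK , λ y → maxK y ∘ A⊆A′

  basisOf-maxCard : BasisOf A J → I ⊆ A → Indep I → ∣ I ∣ ≤ ∣ J ∣
  basisOf-maxCard {J = J} {I = I} (_ , indJ , maxJ) I⊆A indI with ∣ J ∣ <? ∣ I ∣
  ... | no ¬J<I = ≮⇒≥ ¬J<I
  ... | yes J<I =
    let (y , y∈I , y∉J , indJy) = indep-aug indJ indI J<I in ⊥-elim (maxJ y (I⊆A y∈I) y∉J indJy)

  -- The augmentation axiom makes the choice of basis irrelevant.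
  ∉cl-intro : BasisOf A J → x ∉ J → Indep (J ∪ ⁅ x ⁆) → x ∉cl A
  ∉cl-intro {x = x} basisJ@(J⊆A , indJ , maxJ) x∉J indJx J′ basisJ′@(J′⊆A , indJ′ , maxJ′) =
    x∉J′ , indJ′x
    where
    x∉J′ : x ∉ J′
    x∉J′ x∈J′ = maxJ x (J′⊆A x∈J′) x∉J indJx

    indJ′x : Indep (J′ ∪ ⁅ x ⁆)
    indJ′x with indep? (J′ ∪ ⁅ x ⁆)
    ... | yes ind = ind
    ... | no dep =
      let (y , y∈Jx , y∉J′ , indJ′y) = indep-aug indJ′ indJx
                                         (≤-<-trans (basisOf-maxCard basisJ J′⊆A indJ′) (∣p∣<∣p∪⁅x⁆∣ x∉J))
      in ⊥-elim ([ (λ y∈J → maxJ′ y (J⊆A y∈J) y∉J′ indJ′y)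
         , (λ y∈⁅x⁆ → dep (subst (λ z → Indep (J′ ∪ ⁅ z ⁆)) (x∈⁅y⁆⇒x≡y _ y∈⁅x⁆) indJ′y)) ]′ (∈∪⁻ y∈Jx))

  ∉cl? : ∀ x A → Dec (x ∉cl A)
  ∉cl? x A with basisOf-exists A
  ... | J , basisJ with x ∈? J
  ...   | yes x∈J = no λ x∉clA → proj₁ (x∉clA J basisJ) x∈J
  ...   | no x∉J with indep? (J ∪ ⁅ x ⁆)
  ...     | yes indJx = yes (∉cl-intro basisJ x∉J indJx)
  ...     | no depJx = no λ x∉clA → depJx (proj₂ (x∉clA J basisJ))

  ∉cl-stable : ¬ x ∈cl A → x ∉cl A
  ∉cl-stable = decidable-stable (∉cl? _ _)

  ∉cl⇒∉ : x ∉cl A → x ∉ A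
  ∉cl⇒∉ {A = A} x∉clA x∈A =
    let (J , basisJ@(_ , _ , maxJ)) = basisOf-exists A ; (x∉J , indJx) = x∉clA J basisJ
    in maxJ _ x∈A x∉J indJx

  ∈⇒∈cl : x ∈ A → x ∈cl A
  ∈⇒∈cl x∈A x∉clA = ∉cl⇒∉ x∉clA x∈A

  ∉cl⇒indep-∪ : Indep A → x ∉cl A → Indep (A ∪ ⁅ x ⁆)
  ∉cl⇒indep-∪ indA x∉clA = proj₂ (x∉clA _ (basisOf-self indA))

  ∈cl⇒dependent : x ∈cl A → BasisOf A J → x ∉ J → ¬ Indep (J ∪ ⁅ x ⁆)
  ∈cl⇒dependent x∈clA basisJ x∉J indJx = x∈clA (∉cl-intro basisJ x∉J indJx)

  basisOf⇒spans : BasisOf A J → y ∈ A → y ∈cl J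
  basisOf⇒spans (_ , indJ , maxJ) y∈A y∉clJ =
    let (y∉J , indJy) = y∉clJ _ (basisOf-self indJ) in maxJ _ y∈A y∉J indJy

  basis⇒spanning : Whole.Basis M J → Spanning J
  basis⇒spanning basisJ x = basisOf⇒spans basisJ ∈∁∅

  basisOf-extend : BasisOf A K → A ⊆ A′ → (∀ y → y ∈ A′ → y ∉ A → y ∈cl A) → BasisOf A′ K
  basisOf-extend {A = A} {K = K} {A′ = A′} basisK@(K⊆A , indK , maxK) A⊆A′ spanned =
    A⊆A′ ∘ K⊆A , indK , maxK′
    where
    maxK′ : ∀ y → y ∈ A′ → y ∉ K → ¬ Indep (K ∪ ⁅ y ⁆)
    maxK′ y y∈A′ y∉K with y ∈? A
    ... | yes y∈A = maxK y y∈A y∉K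
    ... | no y∉A = ∈cl⇒dependent (spanned y y∈A′ y∉A) basisK y∉K

  ∉cl-antitone : A ⊆ A′ → x ∉cl A′ → x ∉cl A
  ∉cl-antitone {A = A} A⊆A′ x∉clA′ =
    let (J , basisJ@(J⊆A , indJ , _)) = basisOf-exists A
        (J′ , J⊆J′ , basisJ′) = extendToBasisOf (A⊆A′ ∘ J⊆A) indJ
        (x∉J′ , indJ′x) = x∉clA′ J′ basisJ′
    in ∉cl-intro basisJ (x∉J′ ∘ J⊆J′) (indep-⊆ (∪-mono J⊆J′ id) indJ′x)

  ∈cl-trans : x ∈cl S → (∀ s → s ∈ S → s ∈cl T) → x ∈cl T
  ∈cl-trans {T = T} x∈clS S⊆clT x∉clT =
    let (J , basisJ) = basisOf-exists T
        (x∉J , indJx) = x∉clT J basisJ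
        basisJ′ = basisOf-extend basisJ ∈∪ˡ λ y y∈T∪S y∉T →
                    [ (λ y∈T → ⊥-elim (y∉T y∈T)) , S⊆clT y ]′ (∈∪⁻ y∈T∪S)
    in x∈clS (∉cl-antitone (∈∪ʳ {p = T}) (∉cl-intro basisJ′ x∉J indJx))

  spanning-basisOf⇒basis : BasisOf A J → Spanning A → Whole.Basis M J
  spanning-basisOf⇒basis basisJ@(_ , indJ , _) spanning =
    (λ _ → ∈∁∅) , indJ ,
    λ x _ → ∈cl⇒dependent (∈cl-trans (spanning x) (λ _ → basisOf⇒spans basisJ)) (basisOf-self indJ)

  -- y is a coloop of M | A; A′ plays the role of A - y.
  coloop∈basisOf : A′ ⊆ A → (∀ z → z ∈ A → z ≢ y → z ∈ A′) → y ∈ A → y ∉cl A′ → BasisOf A K → y ∈ K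
  coloop∈basisOf {A′ = A′} {y = y} {K = K} A′⊆A A-y⊆A′ y∈A y∉clA′ basisK@(K⊆A , _ , maxK) with y ∈? K
  ... | yes y∈K = y∈K
  ... | no y∉K = ⊥-elim (maxK y y∈A y∉K (proj₂ (y∉clA′ K (basisOf-restrict basisK K⊆A′ A′⊆A))))
    where
    K⊆A′ : K ⊆ A′
    K⊆A′ {z} z∈K = A-y⊆A′ z (K⊆A z∈K) λ { refl → y∉K z∈K }

  basisOf-∪ : BasisOf A J → Indep (I ∪ J) → BasisOf (I ∪ A) (I ∪ J)
  basisOf-∪ (J⊆A , _ , maxJ) indIJ =
    ∪-mono id J⊆A , indIJ ,
    λ y y∈IA y∉IJ indIJy → [ (λ y∈I → y∉IJ (∈∪ˡ y∈I))
                           , (λ y∈A → maxJ y y∈A (y∉IJ ∘ ∈∪ʳ) (indep-⊆ (∪-mono ∈∪ʳ id) indIJy)) ]′ (∈∪⁻ y∈IA)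

  indep-∪-basisOf-transfer : ∀ {C X BC BC′} → X ⊆ ∁ C → BasisOf C BC → BasisOf C BC′ →
                             Indep (X ∪ BC′) → Indep (X ∪ BC)
  indep-∪-basisOf-transfer {C} {X} X⊆∁C (BC⊆C , indBC , _) basisBC′@(BC′⊆C , _ , _) indXBC′ =
    let (K , BC⊆K , basisK@(_ , indK , _)) = extendToBasisOf {A = X ∪ C} (∈∪ʳ ∘ BC⊆C) indBC
    in indep-⊆ (∪-lub (X⊆basisOf basisK) BC⊆K) indK
    where
    x∉cl-rest : ∀ {x} → x ∈ X → x ∉cl (X - x) ∪ C
    x∉cl-rest {x} x∈X =
      ∉cl-intro (basisOf-∪ basisBC′ (indep-⊆ (∪-mono x∈p-y⇒x∈p id) indXBC′))
        (λ x∈ → [ (λ x∈X-x → x∈p-y⇒x≢y x∈X-x refl)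
                , (λ x∈BC′ → x∈∁p⇒x∉p (X⊆∁C x∈X) (BC′⊆C x∈BC′)) ]′ (∈∪⁻ x∈))
        (indep-⊆ (∪-lub (∪-mono x∈p-y⇒x∈p id) (⁅⁆⊆ (∈∪ˡ x∈X))) indXBC′)

    X⊆basisOf : ∀ {K} → BasisOf (X ∪ C) K → X ⊆ K
    X⊆basisOf {K} basisK@(K⊆X∪C , _ , maxK) {x} x∈X with x ∈? K
    ... | yes x∈K = x∈K
    ... | no x∉K = ⊥-elim (maxK x (∈∪ˡ x∈X) x∉K
                     (proj₂ (x∉cl-rest x∈X K (basisOf-restrict basisK K⊆ (∪-mono x∈p-y⇒x∈p id)))))
      where
      K⊆ : K ⊆ (X - x) ∪ C
      K⊆ {k} k∈K = [ (λ k∈X → ∈∪ˡ (x∈p∧x≢y⇒x∈p-y k∈X λ { refl → x∉K k∈K })) , ∈∪ʳ ]′ (∈∪⁻ (K⊆X∪C k∈K))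

  basis? : ∀ B → Dec (Whole.Basis M B)
  basis? B = B ⊆? ∁ ∅ ×-dec indep? B ×-dec
             all? (λ e → e ∈? ∁ ∅ →-dec ¬? (e ∈? B) →-dec ¬? (indep? (B ∪ ⁅ e ⁆)))

  meets? : ∀ (X B : Subset n) → Dec (∃[ e ] (e ∈ X × e ∈ B))
  meets? X B = any? λ e → e ∈? X ×-dec e ∈? B

  meetsAllBases? : ∀ X → Dec (Whole.MeetsAllBases M X)
  meetsAllBases? X with anySubset? (λ B → basis? B ×-dec ¬? (meets? X B))
  ... | yes (B , basisB , misses) = no λ meetsAll → misses (meetsAll B basisB)
  ... | no none = yes λ B basisB → decidable-stable (meets? X B) λ misses → none (B , basisB , misses)

  meetsAllBases⇒cocircuit⊆ : Whole.MeetsAllBases M X₀ → ∃[ X ] (X ⊆ X₀ × Whole.Cocircuit M X)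
  meetsAllBases⇒cocircuit⊆ meets =
    let (X , X⊆X₀ , meetsX , minX) = minimalSubset meetsAllBases? meets
    in X , X⊆X₀ , (λ _ → ∈∁∅) , meetsX , minX

  dependent⇒circuit⊆ : ¬ Indep X₀ → ∃[ X ] (X ⊆ X₀ × Whole.Circuit M X)
  dependent⇒circuit⊆ dep =
    let (X , X⊆X₀ , depX , minX) = minimalSubset (¬? ∘ indep?) dep
    in X , X⊆X₀ , (λ _ → ∈∁∅) , depX , λ Y Y⊂X → decidable-stable (indep? Y) (minX Y Y⊂X)

  meetsAllBases⇒¬spanning-∁ : Whole.MeetsAllBases M X → ¬ Spanning (∁ X)
  meetsAllBases⇒¬spanning-∁ {X} meets spanning =
    let (J , basisJ@(J⊆∁X , _ , _)) = basisOf-exists (∁ X)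
        (z , z∈X , z∈J) = meets J (spanning-basisOf⇒basis basisJ spanning)
    in x∈∁p⇒x∉p (J⊆∁X z∈J) z∈X

  adaptedBasis-exists : ∀ {P F} → PSubbasis M P F → ∃ (AdaptedBasis M P F)
  adaptedBasis-exists {P} {F} (_ , indF , B₀ , basisB₀ , B₀⊆F∪P) =
    let (B , F⊆B , basisB@(B⊆F∪P , _)) = extendToBasisOf {A = F ∪ P} ∈∪ˡ indF
        F∪P-spanning : Spanning (F ∪ P)
        F∪P-spanning x = ∈cl-trans (basis⇒spanning basisB₀ x) (λ _ → ∈⇒∈cl ∘ B₀⊆F∪P)
    in B , spanning-basisOf⇒basis basisB F∪P-spanning , F⊆B , B⊆F∪P

  least-in-fundamentalCocircuit :
    ∀ {B e} (O : Fin n → ℕ) → Whole.Basis M B →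
    (∀ B′ → Whole.Basis M B′ → ∃[ f ] (f ∈ B′ × O e ≤ O f × f ∉ B - e)) →
    ∃[ X ] (Whole.Cocircuit M X × (∀ f → f ∈ X → f ∉ B - e) × IsOLeast M O e X)
  least-in-fundamentalCocircuit {B} {e} O basisB bases-meet =
    let (X , X⊆X₀ , cocircuitX@(_ , meetsX , _)) =
          meetsAllBases⇒cocircuit⊆ {X₀ = subsetOf X₀?} λ B′ basisB′ →
            let (f , f∈B′ , f∈X₀) = bases-meet B′ basisB′ in f , ∈subsetOf⁺ X₀? f∈X₀ , f∈B′
        avoids = λ f f∈X → proj₂ (∈subsetOf⁻ X₀? (X⊆X₀ f∈X))
        (z , z∈X , z∈B) = meetsX B basisB
        z≡e = decidable-stable (z ≟ e) λ z≢e → avoids z z∈X (x∈p∧x≢y⇒x∈p-y z∈B z≢e)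
    in X , cocircuitX , avoids , subst (_∈ X) z≡e z∈X , λ f f∈X → proj₁ (∈subsetOf⁻ X₀? (X⊆X₀ f∈X))
    where
    X₀? : ∀ f → Dec (O e ≤ O f × f ∉ B - e)
    X₀? f = O e ≤? O f ×-dec ¬? (f ∈? B - e)

  least-in-fundamentalCircuit :
    ∀ {B e} (O : Fin n → ℕ) → Indep S → S ⊆ B → e ∉ S → e ∈cl S → (∀ f → f ∈ S → O e < O f) →
    ∃[ X ] (Whole.Circuit M X × X ⊆ B ∪ ⁅ e ⁆ × IsOLeast M O e X)
  least-in-fundamentalCircuit {S} {B} {e} O indS S⊆B e∉S e∈clS e<S =
    let (X , X⊆S∪e , circuitX@(_ , depX , _)) =
          dependent⇒circuit⊆ (∈cl⇒dependent e∈clS (basisOf-self indS) e∉S)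
        e∈X = decidable-stable (e ∈? X) λ e∉X →
                depX (indep-⊆ (λ x∈X → [ id , (λ { refl → ⊥-elim (e∉X x∈X) }) ]′
                                         (x∈p∪⁅y⁆⁻ (X⊆S∪e x∈X))) indS)
        least = λ f f∈X → [ <⇒≤ ∘ e<S f , (λ { refl → ≤-refl }) ]′ (x∈p∪⁅y⁆⁻ (X⊆S∪e f∈X))
    in X , circuitX , ∪-mono S⊆B id ∘ X⊆S∪e , e∈X , least

-- Minors M / C ＼ D

module Minors {n : ℕ} (M : Matroid n) where
  open Matroid M
  open Closure M

  private
    variable
      B BC C D J K S : Subset n
      d e : Fin n

  Disjoint : Subset n → Subset n → Set
  Disjoint C D = ∀ {x} → x ∈ C → x ∉ D

  -- e is a coloop of the deletion M ＼ D.
  DeletionColoop : Subset n → Fin n → Set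
  DeletionColoop D e = e ∉cl ∁ (D ∪ ⁅ e ⁆)

  NonSep : Subset n → Subset n → Fin n → Set
  NonSep C D e = e ∈ minorGround M C D × e ∉cl C × ¬ DeletionColoop D e

  deletionColoop-mono : ∀ {D′} → D ⊆ D′ → DeletionColoop D e → DeletionColoop D′ e
  deletionColoop-mono D⊆D′ = ∉cl-antitone (p⊆q⇒∁p⊇∁q (∪-mono D⊆D′ id))

  ⊆∁[D∪⁅e⁆] : Disjoint C D → e ∉ C → C ⊆ ∁ (D ∪ ⁅ e ⁆)
  ⊆∁[D∪⁅e⁆] C∩D=∅ e∉C c∈C = x∈∁[p∪q]⁺ (C∩D=∅ c∈C) (x≢y⇒x∉⁅y⁆ λ { refl → e∉C c∈C })

  deletionColoop∈basisOf : e ∉ D → DeletionColoop D e → BasisOf (∁ D) K → e ∈ K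
  deletionColoop∈basisOf e∉D =
    coloop∈basisOf (p⊆q⇒∁p⊇∁q ∈∪ˡ)
      (λ z z∈∁D z≢e → x∈∁[p∪q]⁺ (x∈∁p⇒x∉p z∈∁D) (x≢y⇒x∉⁅y⁆ z≢e)) (x∉p⇒x∈∁p e∉D)

  ∈cl⇒¬deletionColoop : Disjoint C D → e ∉ C → e ∈cl C → ¬ DeletionColoop D e
  ∈cl⇒¬deletionColoop C∩D=∅ e∉C e∈clC = e∈clC ∘ ∉cl-antitone (⊆∁[D∪⁅e⁆] C∩D=∅ e∉C)

  loop⇒∈cl : Minor.Loop M C D e → e ∈cl C
  loop⇒∈cl {C = C} (e∈G , dep) e∉clC =
    let (BC , basisBC) = basisOf-exists C
    in dep (⁅⁆⊆ e∈G , BC , basisBC , subst Indep (∪-comm _ _) (proj₂ (e∉clC BC basisBC)))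

  ∈cl⇒loop : e ∈ minorGround M C D → e ∈cl C → Minor.Loop M C D e
  ∈cl⇒loop e∈G e∈clC = e∈G , λ (_ , BC , basisBC@(BC⊆C , _) , ind) →
    e∈clC (∉cl-intro basisBC (proj₁ (x∈∁[p∪q]⁻ e∈G) ∘ BC⊆C) (subst Indep (∪-comm _ _) ind))

  minorBasis⇒basisOf : Disjoint C D → Minor.Basis M C D B →
                       ∃[ BC ] (BasisOf C BC × BasisOf (∁ D) (B ∪ BC))
  minorBasis⇒basisOf {C = C} {D = D} {B = B} C∩D=∅
                     (B⊆G , (_ , BC , basisBC@(BC⊆C , _ , maxBC) , indB∪BC) , maxB) =
    BC , basisBC ,
    ∪-lub (x∉p⇒x∈∁p ∘ proj₂ ∘ x∈∁[p∪q]⁻ ∘ B⊆G) (x∉p⇒x∈∁p ∘ C∩D=∅ ∘ BC⊆C) , indB∪BC , maximal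
    where
    maximal : ∀ y → y ∈ ∁ D → y ∉ B ∪ BC → ¬ Indep ((B ∪ BC) ∪ ⁅ y ⁆)
    maximal y y∈∁D y∉B∪BC ind with y ∈? C
    ... | yes y∈C = maxBC y y∈C (y∉B∪BC ∘ ∈∪ʳ) (indep-⊆ (∪-mono ∈∪ʳ id) ind)
    ... | no y∉C =
      let y∈G = x∈∁[p∪q]⁺ y∉C (x∈∁p⇒x∉p y∈∁D)
      in maxB y y∈G (y∉B∪BC ∘ ∈∪ˡ)
           (∪-lub B⊆G (⁅⁆⊆ y∈G) , BC , basisBC , indep-⊆ (∪-lub (∪-mono ∈∪ˡ id) (∈∪ˡ ∘ ∈∪ʳ)) ind)

  basisOf⇒minorBasis : Disjoint C D → BasisOf C BC → BC ⊆ K → BasisOf (∁ D) K →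
                       Minor.Basis M C D (K ─ C)
  basisOf⇒minorBasis {C = C} {D = D} {BC = BC} {K = K}
                     C∩D=∅ basisBC@(_ , _ , maxBC) BC⊆K (K⊆∁D , indK , maxK) =
    K─C⊆G , (K─C⊆G , BC , basisBC , indep-⊆ (∪-lub (p─q⊆p K C) BC⊆K) indK) , maximal
    where
    K─C⊆G : K ─ C ⊆ minorGround M C D
    K─C⊆G k∈K─C = x∈∁[p∪q]⁺ (x∈p─q⇒x∉q K C k∈K─C) (x∈∁p⇒x∉p (K⊆∁D (p─q⊆p K C k∈K─C)))

    K⊆K─C∪BC : K ⊆ (K ─ C) ∪ BC
    K⊆K─C∪BC {k} k∈K with k ∈? C | k ∈? BC
    ... | no k∉C | _        = ∈∪ˡ (x∈p∧x∉q⇒x∈p─q k∈K k∉C)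
    ... | yes _  | yes k∈BC = ∈∪ʳ k∈BC
    ... | yes k∈C | no k∉BC = ⊥-elim (maxBC k k∈C k∉BC (indep-⊆ (∪-lub BC⊆K (⁅⁆⊆ k∈K)) indK))

    maximal : ∀ y → y ∈ minorGround M C D → y ∉ K ─ C → ¬ MinorIndep M C D ((K ─ C) ∪ ⁅ y ⁆)
    maximal y y∈G y∉K─C (_ , BC′ , basisBC′ , ind′) =
      maxK y (x∉p⇒x∈∁p y∉D) (y∉K─C ∘ λ y∈K → x∈p∧x∉q⇒x∈p─q y∈K y∉C)
        (indep-⊆ (∪-lub (∪-mono ∈∪ˡ id ∘ K⊆K─C∪BC) (∈∪ˡ ∘ ∈∪ʳ)) ind)
      where
      y∉C : y ∉ C
      y∉C = proj₁ (x∈∁[p∪q]⁻ y∈G)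

      y∉D : y ∉ D
      y∉D = proj₂ (x∈∁[p∪q]⁻ y∈G)

      ind : Indep (((K ─ C) ∪ ⁅ y ⁆) ∪ BC)
      ind = indep-∪-basisOf-transfer (∪-lub (x∉p⇒x∈∁p ∘ x∈p─q⇒x∉q K C) (⁅⁆⊆ (x∉p⇒x∈∁p y∉C)))
              basisBC basisBC′ ind′

  deletionColoop⇒coloop : Disjoint C D → e ∈ minorGround M C D → DeletionColoop D e →
                          Minor.Coloop M C D e
  deletionColoop⇒coloop C∩D=∅ e∈G e∉cl = e∈G , λ B basisB →
    let (BC , (BC⊆C , _) , basisB∪BC) = minorBasis⇒basisOf C∩D=∅ basisB
        (e∉C , e∉D) = x∈∁[p∪q]⁻ e∈G
    in [ id , (λ e∈BC → ⊥-elim (e∉C (BC⊆C e∈BC))) ]′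
         (∈∪⁻ (deletionColoop∈basisOf e∉D e∉cl basisB∪BC))

  coloop⇒deletionColoop : Disjoint C D → Minor.Coloop M C D e → DeletionColoop D e
  coloop⇒deletionColoop {C = C} {D = D} {e = e} C∩D=∅ (e∈G , e∈bases) with ∉cl? e (∁ (D ∪ ⁅ e ⁆))
  ... | yes e∉cl = e∉cl
  ... | no e∈cl =
    let (BC , basisBC@(BC⊆C , indBC , _)) = basisOf-exists C
        (K , BC⊆K , basisK@(K⊆∁[D∪e] , _)) = extendToBasisOf (⊆∁[D∪⁅e⁆] C∩D=∅ e∉C ∘ BC⊆C) indBC
        basisK′ = basisOf-extend basisK (p⊆q⇒∁p⊇∁q ∈∪ˡ) only-e-added
        e∈K = p─q⊆p K C (e∈bases (K ─ C) (basisOf⇒minorBasis C∩D=∅ basisBC BC⊆K basisK′))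
    in ⊥-elim (proj₂ (x∈∁[p∪q]⁻ (K⊆∁[D∪e] e∈K)) (x∈⁅x⁆ e))
    where
    e∉C : e ∉ C
    e∉C = proj₁ (x∈∁[p∪q]⁻ e∈G)

    only-e-added : ∀ y → y ∈ ∁ D → y ∉ ∁ (D ∪ ⁅ e ⁆) → y ∈cl ∁ (D ∪ ⁅ e ⁆)
    only-e-added y y∈∁D y∉ with y ≟ e
    ... | yes refl = e∈cl
    ... | no y≢e = ⊥-elim (y∉ (x∈∁[p∪q]⁺ (x∈∁p⇒x∉p y∈∁D) (x≢y⇒x∉⁅y⁆ y≢e)))

  nonSeparating⇒NonSep : Disjoint C D → Minor.NonSeparating M C D e → NonSep C D e
  nonSeparating⇒NonSep C∩D=∅ (e∈G , ¬loop , ¬coloop) =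
    e∈G , ∉cl-stable (¬loop ∘ ∈cl⇒loop e∈G) , ¬coloop ∘ deletionColoop⇒coloop C∩D=∅ e∈G

  NonSep⇒nonSeparating : Disjoint C D → NonSep C D e → Minor.NonSeparating M C D e
  NonSep⇒nonSeparating C∩D=∅ (e∈G , e∉clC , ¬coloop) =
    e∈G , (λ loop → loop⇒∈cl loop e∉clC) , ¬coloop ∘ coloop⇒deletionColoop C∩D=∅

  ∉cl-within-basisOf : BasisOf C J → d ∉ J → J ∪ ⁅ d ⁆ ⊆ K → BasisOf (∁ D) K →
                       (∀ y → y ∈ S → y ∈ C ⊎ (y ∉ D × y ≢ d × DeletionColoop D y)) → d ∉cl S
  ∉cl-within-basisOf {J = J} {d = d} {K = K} {S = S} basisJ d∉J J∪d⊆K basisK@(_ , indK , _) S⊆ =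
    ∉cl-stable λ d∈clS → ∈cl-trans d∈clS S⊆cl d∉clK-d
    where
    J⊆K-d : J ⊆ K - d
    J⊆K-d j∈J = x∈p∧x≢y⇒x∈p-y (J∪d⊆K (∈∪ˡ j∈J)) λ { refl → d∉J j∈J }

    d∉clK-d : d ∉cl K - d
    d∉clK-d = ∉cl-intro (basisOf-self (indep-⊆ x∈p-y⇒x∈p indK)) (λ d∈K-d → x∈p-y⇒x≢y d∈K-d refl)
                (indep-⊆ (∪-lub x∈p-y⇒x∈p (⁅⁆⊆ (J∪d⊆K (∈∪ʳ (x∈⁅x⁆ d))))) indK)

    S⊆cl : ∀ s → s ∈ S → s ∈cl K - d
    S⊆cl s s∈S = [ (λ s∈C → basisOf⇒spans basisJ s∈C ∘ ∉cl-antitone J⊆K-d)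
                 , (λ (s∉D , s≢d , coloop) →
                      ∈⇒∈cl (x∈p∧x≢y⇒x∈p-y (deletionColoop∈basisOf s∉D coloop basisK) s≢d)) ]′ (S⊆ s s∈S)

  ∉cl-contracted∪deletionColoops : Disjoint C D → d ∉ D → d ∉cl C →
    (∀ y → y ∈ S → y ∈ C ⊎ (y ∉ D × y ≢ d × DeletionColoop D y)) → d ∉cl S
  ∉cl-contracted∪deletionColoops {C = C} C∩D=∅ d∉D d∉clC =
    let (J , basisJ@(J⊆C , _)) = basisOf-exists C
        (d∉J , indJ∪d) = d∉clC J basisJ
        (K , J∪d⊆K , basisK) =
          extendToBasisOf (∪-lub (x∉p⇒x∈∁p ∘ C∩D=∅ ∘ J⊆C) (⁅⁆⊆ (x∉p⇒x∈∁p d∉D))) indJ∪d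
    in ∉cl-within-basisOf basisJ d∉J J∪d⊆K basisK

-- The computation tree

module ComputationTree {n : ℕ} (M : Matroid n) (P : Subset n) (O : Fin n → ℕ)
                       (O-injective : Injective _≡_ _≡_ O)
                       (ports-first : ∀ p e → p ∈ P → e ∉ P → O p < O e) where
  open Matroid M
  open Closure M
  open Minors M

  EColoop : Subset n → Subset n → Fin n → Set
  EColoop C D y = y ∉ P × y ∈ minorGround M C D × DeletionColoop D y

  record Invariant (C D : Subset n) : Set where
    field
      contracted∉P       : ∀ {x} → x ∈ C → x ∉ P
      deleted∉P          : ∀ {x} → x ∈ D → x ∉ P
      disjoint           : Disjoint C D
      nonSep<removed     : ∀ {x f} → x ∈ C ⊎ x ∈ D → f ∉ P → NonSep C D f → O f < O x
      coloop-free        : ∀ {e} → e ∉ P → e ∈ minorGround M C D → DeletionColoop D e →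
                           ∀ S → (∀ y → y ∈ S → y ≢ e × (y ∈ D → O y < O e)) → e ∉cl S
      loop-spanned       : ∀ {e} → e ∉ P → e ∈ minorGround M C D → e ∈cl C →
                           ∀ S → (∀ y → y ∈ C → O e < O y → y ∈ S) → e ∈cl S
      contracted-spanned : ∀ {x} → x ∈ C →
                           ∀ S → (∀ y → (y ∈ C × y ≢ x) ⊎ O y < O x ⊎ EColoop C D y → y ∈ S) → x ∈cl S
      deleted-free       : ∀ {x} → x ∈ D →
                           ∀ S → (∀ y → y ∈ S → O x < O y × (y ∈ C ⊎ EColoop C D y)) → x ∉cl S

  invariant-root : Invariant ∅ ∅
  invariant-root = record
    { contracted∉P       = ⊥-elim ∘ ∉⊥
    ; deleted∉P          = ⊥-elim ∘ ∉⊥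
    ; disjoint           = ⊥-elim ∘ ∉⊥
    ; nonSep<removed     = ⊥-elim ∘ [ ∉⊥ , ∉⊥ ]′
    ; coloop-free        = λ _ _ e∉cl S S⊆ →
        ∉cl-antitone (λ {y} y∈S → x∈∁[p∪q]⁺ ∉⊥ (x≢y⇒x∉⁅y⁆ (proj₁ (S⊆ y y∈S)))) e∉cl
    ; loop-spanned       = λ _ _ e∈cl∅ _ _ → e∈cl∅ ∘ ∉cl-antitone ⊥⊆
    ; contracted-spanned = ⊥-elim ∘ ∉⊥
    ; deleted-free       = ⊥-elim ∘ ∉⊥
    }

  module Step {C D d} (inv : Invariant C D) (greatest : GreatestNonSep M P O C D d) where
    open Invariant inv

    d∉P : d ∉ P
    d∉P = proj₁ greatest

    d-nonSep : NonSep C D d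
    d-nonSep = nonSeparating⇒NonSep disjoint (proj₁ (proj₂ greatest))

    d∉C : d ∉ C
    d∉C = proj₁ (x∈∁[p∪q]⁻ (proj₁ d-nonSep))

    d∉D : d ∉ D
    d∉D = proj₂ (x∈∁[p∪q]⁻ (proj₁ d-nonSep))

    d∉clC : d ∉cl C
    d∉clC = proj₁ (proj₂ d-nonSep)

    d-not-coloop : ¬ DeletionColoop D d
    d-not-coloop = proj₂ (proj₂ d-nonSep)

    nonSep<d : ∀ {f} → f ∉ P → NonSep C D f → f ≢ d → O f < O d
    nonSep<d f∉P f-nonSep f≢d =
      ≤∧≢⇒< (proj₂ (proj₂ greatest) _ f∉P (NonSep⇒nonSeparating disjoint f-nonSep)) (f≢d ∘ O-injective)

    nonSep<removed∪d : ∀ {x f} → x ∈ C ⊎ x ∈ D ⊎ x ≡ d → f ∉ P → NonSep C D f → f ≢ d → O f < O x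
    nonSep<removed∪d (inj₁ x∈C)        f∉P f-nonSep _   = nonSep<removed (inj₁ x∈C) f∉P f-nonSep
    nonSep<removed∪d (inj₂ (inj₁ x∈D)) f∉P f-nonSep _   = nonSep<removed (inj₂ x∈D) f∉P f-nonSep
    nonSep<removed∪d (inj₂ (inj₂ refl)) f∉P f-nonSep f≢d = nonSep<d f∉P f-nonSep f≢d

    ground-contract⁻ : ∀ {y} → y ∈ minorGround M (C ∪ ⁅ d ⁆) D → y ∈ minorGround M C D × y ≢ d
    ground-contract⁻ y∈G′ =
      let (y∉C∪d , y∉D) = x∈∁[p∪q]⁻ y∈G′
      in x∈∁[p∪q]⁺ (y∉C∪d ∘ ∈∪ˡ) y∉D , λ { refl → y∉C∪d (∈∪ʳ (x∈⁅x⁆ d)) }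

    ground-contract⁺ : ∀ {y} → y ∈ minorGround M C D → y ≢ d → y ∈ minorGround M (C ∪ ⁅ d ⁆) D
    ground-contract⁺ y∈G y≢d =
      let (y∉C , y∉D) = x∈∁[p∪q]⁻ y∈G in x∈∁[p∪q]⁺ ([ y∉C , y≢d ]′ ∘ x∈p∪⁅y⁆⁻) y∉D

    disjoint-contract : Disjoint (C ∪ ⁅ d ⁆) D
    disjoint-contract = [ disjoint , (λ { refl → d∉D }) ]′ ∘ x∈p∪⁅y⁆⁻

    nonSep-contract⁻ : ∀ {f} → NonSep (C ∪ ⁅ d ⁆) D f → NonSep C D f × f ≢ d
    nonSep-contract⁻ (f∈G′ , f∉clC∪d , ¬coloop) =
      let (f∈G , f≢d) = ground-contract⁻ f∈G′ in (f∈G , ∉cl-antitone ∈∪ˡ f∉clC∪d , ¬coloop) , f≢d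

    eColoop-contract⁺ : ∀ {y} → EColoop C D y → EColoop (C ∪ ⁅ d ⁆) D y
    eColoop-contract⁺ (y∉P , y∈G , coloop) =
      y∉P , ground-contract⁺ y∈G (λ { refl → d-not-coloop coloop }) , coloop

    eColoop-contract⁻ : ∀ {y} → EColoop (C ∪ ⁅ d ⁆) D y → EColoop C D y
    eColoop-contract⁻ (y∉P , y∈G′ , coloop) = y∉P , proj₁ (ground-contract⁻ y∈G′) , coloop

    loop-spanned-contract : ∀ {e} → e ∉ P → e ∈ minorGround M (C ∪ ⁅ d ⁆) D → e ∈cl C ∪ ⁅ d ⁆ →
                            ∀ S → (∀ y → y ∈ C ∪ ⁅ d ⁆ → O e < O y → y ∈ S) → e ∈cl S
    loop-spanned-contract {e} e∉P e∈G′ e∈clC∪d S above⊆S with ground-contract⁻ e∈G′ | ∉cl? e C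
    ... | e∈G , _ | no e∈clC = loop-spanned e∉P e∈G e∈clC S (λ y → above⊆S y ∘ ∈∪ˡ)
    ... | e∈G , e≢d | yes e∉clC = e∈clC∪d ∘ ∉cl-antitone (λ {y} y∈C∪d → above⊆S y y∈C∪d (e<C∪d y∈C∪d))
      where
      e<C∪d : ∀ {y} → y ∈ C ∪ ⁅ d ⁆ → O e < O y
      e<C∪d y∈C∪d =
        nonSep<removed∪d (Sum.map₂ inj₂ (x∈p∪⁅y⁆⁻ y∈C∪d)) e∉P
          (e∈G , e∉clC , ∈cl⇒¬deletionColoop disjoint-contract (proj₁ (x∈∁[p∪q]⁻ e∈G′)) e∈clC∪d) e≢d

    -- d is not a coloop of M ＼ D, so it lies in the closure of the rest of
    -- M ＼ D, all of which is spanned by C, by the elements below d and by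
    -- the E-coloops, since d is the greatest non-separating element.
    d-spanned : ∀ S → C ⊆ S → (∀ y → O y < O d → y ∈ S) → (∀ y → EColoop (C ∪ ⁅ d ⁆) D y → y ∈ S) →
                d ∈cl S
    d-spanned S C⊆S below⊆S coloops⊆S = ∈cl-trans d-not-coloop (λ t → t∈cl ∘ x∈∁[p∪q]⁻)
      where
      t∈cl : ∀ {t} → t ∉ D × t ∉ ⁅ d ⁆ → t ∈cl S
      t∈cl {t} (t∉D , t∉⁅d⁆) with t ∈? C | O t <? O d | t ∈? P | ∉cl? t C | ∉cl? t (∁ (D ∪ ⁅ t ⁆))
      ... | yes t∈C | _ | _ | _ | _ = ∈⇒∈cl (C⊆S t∈C)
      ... | no _ | yes t<d | _ | _ | _ = ∈⇒∈cl (below⊆S t t<d)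
      ... | no _ | no t≮d | yes t∈P | _ | _ = ⊥-elim (t≮d (ports-first t d t∈P d∉P))
      ... | no _ | no _ | no _ | no t∈clC | _ = t∈clC ∘ ∉cl-antitone C⊆S
      ... | no t∉C | no _ | no t∉P | yes _ | yes coloop =
        ∈⇒∈cl (coloops⊆S t (t∉P , x∈∁[p∪q]⁺ ([ t∉C , t∉⁅d⁆ ]′ ∘ ∈∪⁻) t∉D , coloop))
      ... | no t∉C | no t≮d | no t∉P | yes t∉clC | no ¬coloop =
        ⊥-elim (t≮d (nonSep<d t∉P (x∈∁[p∪q]⁺ t∉C t∉D , t∉clC , ¬coloop) (x∉⁅y⁆⇒x≢y t∉⁅d⁆)))

    contracted-spanned-contract :
      ∀ {x} → x ∈ C ∪ ⁅ d ⁆ → ∀ S →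
      (∀ y → (y ∈ C ∪ ⁅ d ⁆ × y ≢ x) ⊎ O y < O x ⊎ EColoop (C ∪ ⁅ d ⁆) D y → y ∈ S) → x ∈cl S
    contracted-spanned-contract x∈C∪d S ⊆S with x∈p∪⁅y⁆⁻ x∈C∪d
    ... | inj₁ x∈C = contracted-spanned x∈C S λ y →
          ⊆S y ∘ Sum.map (Product.map₁ ∈∪ˡ) (Sum.map₂ eColoop-contract⁺)
    ... | inj₂ refl = d-spanned S
          (λ c∈C → ⊆S _ (inj₁ (∈∪ˡ c∈C , λ { refl → d∉C c∈C })))
          (λ y → ⊆S y ∘ inj₂ ∘ inj₁)
          (λ y → ⊆S y ∘ inj₂ ∘ inj₂)

    deleted-free-contract :
      ∀ {x} → x ∈ D → ∀ S →
      (∀ y → y ∈ S → O x < O y × (y ∈ C ∪ ⁅ d ⁆ ⊎ EColoop (C ∪ ⁅ d ⁆) D y)) → x ∉cl S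
    deleted-free-contract x∈D S S⊆ = deleted-free x∈D S λ y y∈S →
      let (x<y , y∈) = S⊆ y y∈S
          d<x = nonSep<removed (inj₂ x∈D) d∉P d-nonSep
          C∪d⇒C = [ id , (λ { refl → ⊥-elim (<-asym x<y d<x) }) ]′ ∘ x∈p∪⁅y⁆⁻
      in x<y , Sum.map₂ eColoop-contract⁻ (Sum.map₁ C∪d⇒C y∈)

    invariant-contract : Invariant (C ∪ ⁅ d ⁆) D
    invariant-contract = record
      { contracted∉P       = [ contracted∉P , (λ { refl → d∉P }) ]′ ∘ x∈p∪⁅y⁆⁻
      ; deleted∉P          = deleted∉P
      ; disjoint           = disjoint-contract
      ; nonSep<removed     = λ x∈ f∉P f-nonSep′ →
          let (f-nonSep , f≢d) = nonSep-contract⁻ f-nonSep′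
          in nonSep<removed∪d ([ [ inj₁ , inj₂ ∘ inj₂ ]′ ∘ x∈p∪⁅y⁆⁻ , inj₂ ∘ inj₁ ]′ x∈) f∉P f-nonSep f≢d
      ; coloop-free        = λ e∉P → coloop-free e∉P ∘ proj₁ ∘ ground-contract⁻
      ; loop-spanned       = loop-spanned-contract
      ; contracted-spanned = contracted-spanned-contract
      ; deleted-free       = deleted-free-contract
      }

    ground-delete⁻ : ∀ {y} → y ∈ minorGround M C (D ∪ ⁅ d ⁆) → y ∈ minorGround M C D × y ≢ d
    ground-delete⁻ y∈G′ =
      let (y∉C , y∉D∪d) = x∈∁[p∪q]⁻ y∈G′
      in x∈∁[p∪q]⁺ y∉C (y∉D∪d ∘ ∈∪ˡ) , λ { refl → y∉D∪d (∈∪ʳ (x∈⁅x⁆ d)) }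

    ground-delete⁺ : ∀ {y} → y ∈ minorGround M C D → y ≢ d → y ∈ minorGround M C (D ∪ ⁅ d ⁆)
    ground-delete⁺ y∈G y≢d =
      let (y∉C , y∉D) = x∈∁[p∪q]⁻ y∈G in x∈∁[p∪q]⁺ y∉C ([ y∉D , y≢d ]′ ∘ x∈p∪⁅y⁆⁻)

    disjoint-delete : Disjoint C (D ∪ ⁅ d ⁆)
    disjoint-delete x∈C = [ disjoint x∈C , (λ { refl → d∉C x∈C }) ]′ ∘ x∈p∪⁅y⁆⁻

    deletionColoop-delete⁻ : ∀ {y} → y ∈ minorGround M C (D ∪ ⁅ d ⁆) → DeletionColoop (D ∪ ⁅ d ⁆) y →
                             DeletionColoop D y ⊎ NonSep C D y
    deletionColoop-delete⁻ {y} y∈G′ coloop′ with ∉cl? y (∁ (D ∪ ⁅ y ⁆))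
    ... | yes coloop = inj₁ coloop
    ... | no ¬coloop = inj₂ (proj₁ (ground-delete⁻ y∈G′) , y∉clC , ¬coloop)
      where
      y∉clC : y ∉cl C
      y∉clC = ∉cl-stable λ y∈clC →
        ∈cl⇒¬deletionColoop disjoint-delete (proj₁ (x∈∁[p∪q]⁻ y∈G′)) y∈clC coloop′

    eColoop-delete⁺ : ∀ {y} → EColoop C D y → EColoop C (D ∪ ⁅ d ⁆) y
    eColoop-delete⁺ (y∉P , y∈G , coloop) =
      y∉P , ground-delete⁺ y∈G (λ { refl → d-not-coloop coloop }) , deletionColoop-mono ∈∪ˡ coloop

    eColoop-delete⁻ : ∀ {x y} → x ∈ C ⊎ x ∈ D ⊎ x ≡ d → O x < O y →
                      EColoop C (D ∪ ⁅ d ⁆) y → EColoop C D y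
    eColoop-delete⁻ x∈ x<y (y∉P , y∈G′ , coloop′) with deletionColoop-delete⁻ y∈G′ coloop′
    ... | inj₁ coloop = y∉P , proj₁ (ground-delete⁻ y∈G′) , coloop
    ... | inj₂ y-nonSep =
      ⊥-elim (<-asym x<y (nonSep<removed∪d x∈ y∉P y-nonSep (proj₂ (ground-delete⁻ y∈G′))))

    coloop-free-delete : ∀ {e} → e ∉ P → e ∈ minorGround M C (D ∪ ⁅ d ⁆) → DeletionColoop (D ∪ ⁅ d ⁆) e →
                         ∀ S → (∀ y → y ∈ S → y ≢ e × (y ∈ D ∪ ⁅ d ⁆ → O y < O e)) → e ∉cl S
    coloop-free-delete {e} e∉P e∈G′ coloop′ S S⊆ with deletionColoop-delete⁻ e∈G′ coloop′
    ... | inj₁ coloop =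
      coloop-free e∉P (proj₁ (ground-delete⁻ e∈G′)) coloop S (λ y → Product.map₂ (_∘ ∈∪ˡ) ∘ S⊆ y)
    ... | inj₂ e-nonSep = ∉cl-antitone S⊆∁ coloop′
      where
      S⊆∁ : S ⊆ ∁ ((D ∪ ⁅ d ⁆) ∪ ⁅ e ⁆)
      S⊆∁ {y} y∈S =
        let (y≢e , D∪d<e) = S⊆ y y∈S
            e<D∪d = λ y∈D∪d →
              nonSep<removed∪d (inj₂ (x∈p∪⁅y⁆⁻ y∈D∪d)) e∉P e-nonSep (proj₂ (ground-delete⁻ e∈G′))
        in x∈∁[p∪q]⁺ (λ y∈D∪d → <-asym (D∪d<e y∈D∪d) (e<D∪d y∈D∪d)) (x≢y⇒x∉⁅y⁆ y≢e)

    deleted-free-delete :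
      ∀ {x} → x ∈ D ∪ ⁅ d ⁆ → ∀ S →
      (∀ y → y ∈ S → O x < O y × (y ∈ C ⊎ EColoop C (D ∪ ⁅ d ⁆) y)) → x ∉cl S
    deleted-free-delete x∈D∪d S S⊆ with x∈p∪⁅y⁆⁻ x∈D∪d
    ... | inj₁ x∈D = deleted-free x∈D S λ y y∈S →
          Product.map₂ (Sum.map₂ (eColoop-delete⁻ (inj₂ (inj₁ x∈D)) (proj₁ (S⊆ y y∈S)))) (S⊆ y y∈S)
    ... | inj₂ refl = ∉cl-contracted∪deletionColoops disjoint d∉D d∉clC λ y y∈S →
          let (d<y , y∈) = S⊆ y y∈S
              old-coloop : EColoop C (D ∪ ⁅ d ⁆) y → y ∉ D × y ≢ d × DeletionColoop D y
              old-coloop y-coloop =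
                let (_ , y∈G , coloop) = eColoop-delete⁻ (inj₂ (inj₂ refl)) d<y y-coloop
                in proj₂ (x∈∁[p∪q]⁻ y∈G) , (λ { refl → <-irrefl refl d<y }) , coloop
          in Sum.map₂ old-coloop y∈

    invariant-delete : Invariant C (D ∪ ⁅ d ⁆)
    invariant-delete = record
      { contracted∉P       = contracted∉P
      ; deleted∉P          = [ deleted∉P , (λ { refl → d∉P }) ]′ ∘ x∈p∪⁅y⁆⁻
      ; disjoint           = disjoint-delete
      ; nonSep<removed     = λ x∈ f∉P f-nonSep′ →
          let (f∈G′ , f∉clC , ¬coloop′) = f-nonSep′
              (f∈G , f≢d) = ground-delete⁻ f∈G′
          in nonSep<removed∪d (Sum.map₂ x∈p∪⁅y⁆⁻ x∈) f∉P
               (f∈G , f∉clC , ¬coloop′ ∘ deletionColoop-mono ∈∪ˡ) f≢d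
      ; coloop-free        = coloop-free-delete
      ; loop-spanned       = λ e∉P → loop-spanned e∉P ∘ proj₁ ∘ ground-delete⁻
      ; contracted-spanned = λ x∈C S ⊆S →
          contracted-spanned x∈C S λ y → ⊆S y ∘ Sum.map₂ (Sum.map₂ eColoop-delete⁺)
      ; deleted-free       = deleted-free-delete
      }

  invariant : ∀ {C D} → Node M P O C D → Invariant C D
  invariant root                     = invariant-root
  invariant (contract node greatest) = Step.invariant-contract (invariant node) greatest
  invariant (delete node greatest)   = Step.invariant-delete (invariant node) greatest

  module AtLeaf {F C D} (F-subbasis : PSubbasis M P F) (leaf : Leaf M P O C D)
                (belongs : BelongsTo M P F C D) where
    open Invariant (invariant (proj₁ leaf))

    ∈F⇒contracted⊎coloop : ∀ {y} → y ∈ F → y ∈ C ⊎ (y ∈ minorGround M C D × DeletionColoop D y)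
    ∈F⇒contracted⊎coloop y∈F =
      Sum.map proj₂ (λ (_ , coloop) → proj₁ coloop , coloop⇒deletionColoop disjoint coloop)
        (proj₁ (belongs _) y∈F)

    contracted⇒∈F : ∀ {y} → y ∈ C → y ∈ F
    contracted⇒∈F y∈C = proj₂ (belongs _) (inj₁ (contracted∉P y∈C , y∈C))

    eColoop⇒∈F : ∀ {y} → EColoop C D y → y ∈ F
    eColoop⇒∈F (y∉P , y∈G , coloop) =
      proj₂ (belongs _) (inj₂ (y∉P , deletionColoop⇒coloop disjoint y∈G coloop))

    ∈F⇒∉D : ∀ {y} → y ∈ F → y ∉ D
    ∈F⇒∉D = [ disjoint , proj₂ ∘ x∈∁[p∪q]⁻ ∘ proj₁ ]′ ∘ ∈F⇒contracted⊎coloop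

    loop⊎coloop : ∀ {e} → e ∉ P → e ∈ minorGround M C D → e ∈cl C ⊎ DeletionColoop D e
    loop⊎coloop {e} e∉P e∈G with ∉cl? e C | ∉cl? e (∁ (D ∪ ⁅ e ⁆))
    ... | no e∈clC  | _          = inj₁ e∈clC
    ... | yes _     | yes coloop = inj₂ coloop
    ... | yes e∉clC | no ¬coloop =
      ⊥-elim (proj₂ leaf e e∉P (NonSep⇒nonSeparating disjoint (e∈G , e∉clC , ¬coloop)))

    ∉F⇒deleted⊎loop : ∀ {e} → e ∉ P → e ∉ F → e ∈ D ⊎ (e ∈ minorGround M C D × e ∈cl C)
    ∉F⇒deleted⊎loop {e} e∉P e∉F with e ∈? D
    ... | yes e∈D = inj₁ e∈D
    ... | no e∉D = inj₂ (e∈G , [ id , (λ coloop → ⊥-elim (e∉F (eColoop⇒∈F (e∉P , e∈G , coloop)))) ]′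
                                 (loop⊎coloop e∉P e∈G))
      where
      e∈G : e ∈ minorGround M C D
      e∈G = x∈∁[p∪q]⁺ (e∉F ∘ contracted⇒∈F) e∉D

    adapted⇒∉D : ∀ {B y} → AdaptedBasis M P F B → y ∈ B → y ∉ D
    adapted⇒∉D (_ , _ , B⊆F∪P) = [ ∈F⇒∉D , (λ y∈P y∈D → deleted∉P y∈D y∈P) ]′ ∘ ∈∪⁻ ∘ B⊆F∪P

    coloop⇒internallyActive : ∀ {e} → EColoop C D e → InternallyActive M P O F e
    coloop⇒internallyActive {e} e-coloop@(e∉P , e∈G , coloop) =
      let (B , adapted@(basisB , _)) = adaptedBasis-exists F-subbasis
      in e∈F , B , adapted , least-in-fundamentalCocircuit O basisB (bases-meet adapted)
      where
      e∈F : e ∈ F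
      e∈F = eColoop⇒∈F e-coloop

      -- A basis B′ missing all f ≥ e outside B - e would not span e, by coloop-free.
      bases-meet : ∀ {B} → AdaptedBasis M P F B →
                   ∀ B′ → Whole.Basis M B′ → ∃[ f ] (f ∈ B′ × O e ≤ O f × f ∉ B - e)
      bases-meet {B} adapted B′ basisB′ =
        decidable-stable (any? λ f → f ∈? B′ ×-dec O e ≤? O f ×-dec ¬? (f ∈? B - e)) λ none →
          let above⇒∈B-e : ∀ {y} → y ∈ B′ → O e ≤ O y → y ∈ B - e
              above⇒∈B-e {y} y∈B′ e≤y = decidable-stable (y ∈? B - e) λ y∉ → none (y , y∈B′ , e≤y , y∉)
          in basis⇒spanning basisB′ e (coloop-free e∉P e∈G coloop B′ λ y y∈B′ →
               (λ { refl → x∈p-y⇒x≢y (above⇒∈B-e y∈B′ ≤-refl) refl }) ,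
               λ y∈D → ≰⇒> λ e≤y → adapted⇒∉D adapted (x∈p-y⇒x∈p (above⇒∈B-e y∈B′ e≤y)) y∈D)

    contracted⇒¬internallyActive : ∀ {e} → e ∈ C → ¬ InternallyActive M P O F e
    contracted⇒¬internallyActive {e} e∈C
      (_ , B , (basisB , F⊆B , _) , X , (_ , meetsX , _) , avoids , _ , least) =
      meetsAllBases⇒¬spanning-∁ meetsX λ z → ∈cl-trans (basis⇒spanning basisB z) B⊆cl∁X
      where
      F-e⊆∁X : ∀ {y} → y ∈ F → y ≢ e → y ∈ ∁ X
      F-e⊆∁X y∈F y≢e = x∉p⇒x∈∁p λ y∈X → avoids _ y∈X (x∈p∧x≢y⇒x∈p-y (F⊆B y∈F) y≢e)

      e∈cl∁X : e ∈cl ∁ X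
      e∈cl∁X = contracted-spanned e∈C (∁ X) λ y →
        [ (λ (y∈C , y≢e) → F-e⊆∁X (contracted⇒∈F y∈C) y≢e)
        , [ (λ y<e → x∉p⇒x∈∁p λ y∈X → <⇒≱ y<e (least y y∈X))
          , (λ y-coloop@(_ , y∈G , _) →
               F-e⊆∁X (eColoop⇒∈F y-coloop) λ { refl → proj₁ (x∈∁[p∪q]⁻ y∈G) e∈C }) ]′ ]′

      B⊆cl∁X : ∀ b → b ∈ B → b ∈cl ∁ X
      B⊆cl∁X b b∈B with b ≟ e
      ... | yes refl = e∈cl∁X
      ... | no b≢e = ∈⇒∈cl (x∉p⇒x∈∁p λ b∈X → avoids b b∈X (x∈p∧x≢y⇒x∈p-y b∈B b≢e))

    loop⇒externallyActive : ∀ {e} → e ∉ P → e ∈ minorGround M C D → e ∈cl C → ExternallyActive M P O F e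
    loop⇒externallyActive {e} e∉P e∈G e∈clC =
      let (B , adapted@(_ , F⊆B , _)) = adaptedBasis-exists F-subbasis
      in e∉P , e∉F , B , adapted ,
         least-in-fundamentalCircuit O
           (indep-⊆ (proj₁ ∘ ∈S⁻) (proj₁ (proj₂ F-subbasis))) (F⊆B ∘ proj₁ ∘ ∈S⁻)
           (λ e∈S → <-irrefl refl (proj₂ (∈S⁻ e∈S)))
           (loop-spanned e∉P e∈G e∈clC S λ y y∈C e<y → ∈subsetOf⁺ S? (contracted⇒∈F y∈C , e<y))
           (λ f → proj₂ ∘ ∈S⁻)
      where
      e∉C : e ∉ C
      e∉C = proj₁ (x∈∁[p∪q]⁻ e∈G)

      e∉F : e ∉ F
      e∉F = [ e∉C , (λ (_ , coloop) → ∈cl⇒¬deletionColoop disjoint e∉C e∈clC coloop) ]′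
            ∘ ∈F⇒contracted⊎coloop

      S? : ∀ y → Dec (y ∈ F × O e < O y)
      S? y = y ∈? F ×-dec O e <? O y

      S : Subset n
      S = subsetOf S?

      ∈S⁻ : ∀ {y} → y ∈ S → y ∈ F × O e < O y
      ∈S⁻ = ∈subsetOf⁻ S?

    deleted⇒¬externallyActive : ∀ {e} → e ∈ D → ¬ ExternallyActive M P O F e
    deleted⇒¬externallyActive {e} e∈D
      (e∉P , _ , B , (basisB , _ , B⊆F∪P) , X , (_ , depX , _) , X⊆B∪e , e∈X , least) =
      depX (indep-⊆ p⊆p-x∪⁅x⁆ (∉cl⇒indep-∪ (indep-⊆ X-e⊆B (proj₁ (proj₂ basisB)))
              (deleted-free e∈D (X - e) λ y y∈X-e → e<X-e y∈X-e , contracted⊎coloop y∈X-e)))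
      where
      X-e⊆B : X - e ⊆ B
      X-e⊆B y∈X-e = [ id , (λ y∈⁅e⁆ → ⊥-elim (x∈p-y⇒x≢y y∈X-e (x∈⁅y⁆⇒x≡y _ y∈⁅e⁆))) ]′
                      (∈∪⁻ (X⊆B∪e (x∈p-y⇒x∈p y∈X-e)))

      e<X-e : ∀ {y} → y ∈ X - e → O e < O y
      e<X-e y∈X-e = ≤∧≢⇒< (least _ (x∈p-y⇒x∈p y∈X-e)) (x∈p-y⇒x≢y y∈X-e ∘ sym ∘ O-injective)

      contracted⊎coloop : ∀ {y} → y ∈ X - e → y ∈ C ⊎ EColoop C D y
      contracted⊎coloop {y} y∈X-e =
        let y∈F = [ id , (λ y∈P → ⊥-elim (<-asym (ports-first y e y∈P e∉P) (e<X-e y∈X-e))) ]′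
                    (∈∪⁻ (B⊆F∪P (X-e⊆B y∈X-e)))
        in Sum.map₂ (λ (y∈G , coloop) → x∈∁p⇒x∉p (proj₁ F-subbasis y∈F) , y∈G , coloop)
             (∈F⇒contracted⊎coloop y∈F)

    internallyActive⇔ : ∀ {e} → e ∉ P → InternallyActive M P O F e ⇔ LeafInternallyActive M P C D e
    internallyActive⇔ e∉P = mk⇔
      (λ active@(e∈F , _) →
         [ (λ e∈C → ⊥-elim (contracted⇒¬internallyActive e∈C active))
         , (λ (e∈G , coloop) → e∉P , deletionColoop⇒coloop disjoint e∈G coloop) ]′
           (∈F⇒contracted⊎coloop e∈F))
      (λ (_ , coloop) →
         coloop⇒internallyActive (e∉P , proj₁ coloop , coloop⇒deletionColoop disjoint coloop))

    internallyInactive⇔ : ∀ {e} → e ∉ P → InternallyInactive M P O F e ⇔ LeafInternallyPassive M P C D e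
    internallyInactive⇔ e∉P = mk⇔
      (λ (e∈F , inactive) →
         e∉P , [ id , (λ (e∈G , coloop) →
                         ⊥-elim (inactive (coloop⇒internallyActive (e∉P , e∈G , coloop)))) ]′
                 (∈F⇒contracted⊎coloop e∈F))
      (λ (_ , e∈C) → contracted⇒∈F e∈C , contracted⇒¬internallyActive e∈C)

    externallyActive⇔ : ∀ {e} → e ∉ P → ExternallyActive M P O F e ⇔ LeafExternallyActive M P C D e
    externallyActive⇔ e∉P = mk⇔
      (λ active@(_ , e∉F , _) →
         [ (λ e∈D → ⊥-elim (deleted⇒¬externallyActive e∈D active))
         , (λ (e∈G , e∈clC) → e∉P , ∈cl⇒loop e∈G e∈clC) ]′ (∉F⇒deleted⊎loop e∉P e∉F))
      (λ (_ , loop) → loop⇒externallyActive e∉P (proj₁ loop) (loop⇒∈cl loop))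

    externallyInactive⇔ : ∀ {e} → e ∉ P → ExternallyInactive M P O F e ⇔ LeafExternallyPassive M P C D e
    externallyInactive⇔ e∉P = mk⇔
      (λ (_ , e∉F , inactive) →
         e∉P , [ id , (λ (e∈G , e∈clC) → ⊥-elim (inactive (loop⇒externallyActive e∉P e∈G e∈clC))) ]′
                 (∉F⇒deleted⊎loop e∉P e∉F))
      (λ (_ , e∈D) → e∉P , (λ e∈F → ∈F⇒∉D e∈F e∈D) , deleted⇒¬externallyActive e∈D)

proposition36 : ∀ {n : ℕ} (M : Matroid n) (P : Subset n) (O : Fin n → ℕ)
    → Injective _≡_ _≡_ O
    → (∀ p e → p ∈ P → e ∉ P → O p < O e)
    → ∀ (F : Subset n) → PSubbasis M P F
    → ∀ (C D : Subset n) → Leaf M P O C D → BelongsTo M P F C D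
    → ∀ (e : Fin n) → e ∉ P
    → (InternallyActive M P O F e ⇔ LeafInternallyActive M P C D e)
      × (InternallyInactive M P O F e ⇔ LeafInternallyPassive M P C D e)
      × (ExternallyActive M P O F e ⇔ LeafExternallyActive M P C D e)
      × (ExternallyInactive M P O F e ⇔ LeafExternallyPassive M P C D e)
proposition36 M P O O-injective ports-first F F-subbasis C D leaf belongs e e∉P =
  internallyActive⇔ e∉P , internallyInactive⇔ e∉P , externallyActive⇔ e∉P , externallyInactive⇔ e∉P
  where
  open ComputationTree M P O O-injective ports-first
  open AtLeaf F-subbasis leaf belongs
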